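{- For every $n\geq 0$, the map $\psi$ restricts to a bijection from $\mathcal{E}_n$ onto the set of Motzkin paths of length $n$ that contain no occurrence of $UU$ and no occurrence of $UD$, where $\mathcal{E}_n$ is the set of Łukasiewicz paths of length $n$ in which every up step $U_k$ ($k\geq1$) is immediately followed by a flat step $F$ and every flat step at positive height is immediately preceded by an up step $U_k$ for some $k\geq1$.
   Context: A Łukasiewicz path of length $n$ is a sequence of $n$ steps from $\{(1,i): i\geq -1\}$ starting at $(0,0)$, ending at $(n,0)$ and never going below the $x$-axis; a Motzkin path is one with steps in $\{U,F,D\}$. Write $D=(1,-1)$, $F=(1,0)$, $U=U_1=(1,1)$, $U_k=(1,k)$; $\epsilon$ is the empty path. The height of a step is the minimal ordinate of its endpoints. Every nonempty Łukasiewicz path is uniquely either $FL$ or $U_kL_1DL_2D\cdots L_kDL$ with $k\geq1$ and $L,L_1,\dots,L_k$ Łukasiewicz paths. The map $\psi$ is defined recursively by $\psi(\epsilon)=\epsilon$, $\psi(FL)=F\psi(L)$, $\psi(U_kL_1DL_2D\cdots L_kDL)=U\psi(L_1)F\psi(L_2)F\cdots F\psi(L_k)D\psi(L)$. -}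

module Defs where

open import Data.Nat using (ℕ; zero; suc; _+_; _∸_; _<_)
open import Data.List using (List; []; _∷_; _++_; length)
open import Data.List.Relation.Unary.All using (All)
open import Data.Maybe using (Maybe; just; nothing)
open import Data.Product using (_×_; _,_; ∃; ∃-syntax)
open import Data.Unit using (⊤)
open import Data.Empty using (⊥)
open import Relation.Nullary using (¬_)
open import Relation.Binary.PropositionalEquality using (_≡_)

-- Steps of Łukasiewicz paths.  D = (1,-1), F = (1,0), and
-- Up k = U_{k+1} = (1, k+1)  (so the up steps U_k, k ≥ 1, are Up 0, Up 1, ...).
data Step : Set where
  D : Step
  F : Step
  Up : ℕ → Step

U : Step
U = Up 0

Path : Set
Path = List Step

IsLukFrom : ℕ → Path → Set
IsLukFrom h [] = h ≡ 0
IsLukFrom zero (D ∷ w) = ⊥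
IsLukFrom (suc h) (D ∷ w) = IsLukFrom h w
IsLukFrom h (F ∷ w) = IsLukFrom h w
IsLukFrom h (Up k ∷ w) = IsLukFrom (h + suc k) w

IsLuk : Path → Set
IsLuk = IsLukFrom 0

MotzkinStep : Step → Set
MotzkinStep D = ⊤
MotzkinStep F = ⊤
MotzkinStep (Up zero) = ⊤
MotzkinStep (Up (suc _)) = ⊥

IsMotzkin : Path → Set
IsMotzkin w = IsLuk w × All MotzkinStep w

Occurs₂ : Step → Step → Path → Set
Occurs₂ s t w = ∃[ a ] ∃[ b ] (w ≡ a ++ (s ∷ t ∷ b))

UpFollowedByF : Path → Set
UpFollowedByF [] = ⊤
UpFollowedByF (D ∷ w) = UpFollowedByF w
UpFollowedByF (F ∷ w) = UpFollowedByF w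
UpFollowedByF (Up k ∷ []) = ⊥
UpFollowedByF (Up k ∷ s ∷ w) = s ≡ F × UpFollowedByF (s ∷ w)

-- FlatPreceded prev h w : prev is the step just before w (if any), h the current
-- height.
FlatPreceded : Maybe Step → ℕ → Path → Set
FlatPreceded prev h [] = ⊤
FlatPreceded prev h (D ∷ w) = FlatPreceded (just D) (h ∸ 1) w
FlatPreceded prev h (F ∷ w) =
  (0 < h → ∃[ k ] (prev ≡ just (Up k))) × FlatPreceded (just F) h w
FlatPreceded prev h (Up k ∷ w) = FlatPreceded (just (Up k)) (h + suc k) w

InE : ℕ → Path → Set
InE n w = length w ≡ n × IsLuk w × UpFollowedByF w × FlatPreceded nothing 0 w

InM : ℕ → Path → Set
InM n m = length m ≡ n × IsMotzkin m × ¬ Occurs₂ U U m × ¬ Occurs₂ U D m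

-- The map ψ, following the recursive definition through the decomposition
--   ε,   F L,   U_k L_1 D L_2 D ⋯ L_k D L.

-- firstReturn c w : splits w = L ++ D ∷ rest where L is the shortest prefix
-- such that the D right after it goes below the starting level (c is the
-- current level above the start, accumulated in the reversed prefix).
firstReturn : ℕ → Path → Maybe (Path × Path)
firstReturn c [] = nothing
firstReturn zero (D ∷ w) = just ([] , w)
firstReturn (suc c) (D ∷ w) with firstReturn c w
... | nothing = nothing
... | just (l , r) = just (D ∷ l , r)
firstReturn c (F ∷ w) with firstReturn c w
... | nothing = nothing
... | just (l , r) = just (F ∷ l , r)
firstReturn c (Up k ∷ w) with firstReturn (c + suc k) w
... | nothing = nothing
... | just (l , r) = just (Up k ∷ l , r)

-- ψ with a fuel argument (fuel = length suffices; every recursive call is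
-- on a strictly shorter path).  Inputs that are not Łukasiewicz paths
-- are sent to arbitrary junk values.
mutual
  ψ-fuel : ℕ → Path → Path
  ψ-fuel zero w = []
  ψ-fuel (suc f) [] = []
  ψ-fuel (suc f) (F ∷ w) = F ∷ ψ-fuel f w
  ψ-fuel (suc f) (D ∷ w) = []
  ψ-fuel (suc f) (Up k ∷ w) = U ∷ pieces f k w

  -- pieces f m w, for w = L_i D L_{i+1} D ⋯ L_k D L with m = k - i:
  -- outputs ψ(L_i) F ψ(L_{i+1}) F ⋯ F ψ(L_k) D ψ(L)
  pieces : ℕ → ℕ → Path → Path
  pieces f m w with firstReturn 0 w
  ... | nothing = []
  pieces f zero w | just (l , r) = ψ-fuel f l ++ (D ∷ ψ-fuel f r)
  pieces f (suc m) w | just (l , r) = ψ-fuel f l ++ (F ∷ pieces f m r)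

ψ : Path → Path
ψ w = ψ-fuel (length w) w

-- Reading ψ from left to right, it becomes a stack machine: an up step U_k
-- becomes U and opens an entry recording that its first k-1 returns are to be
-- written F, its last return D.  On 𝓔 every U_k is followed by F, and a flat
-- step at positive height occurs only there, so the output is a Motzkin path
-- in which every U is followed by F, i.e. one without UU and UD.  The machine
-- can be run backwards: an output F is an input flat step exactly when no
-- entry is open, and otherwise a return of the innermost open up step; this
-- inverts ψ on 𝓔 and also produces a preimage of every such Motzkin path.
module Submission where

open import Defs
open import Data.Nat using (ℕ; zero; suc; _+_; _≤_; z≤n; s≤s)
open import Data.Nat.Properties
  using (+-suc; +-comm; +-commutativeSemigroup; m+n≤o⇒m≤o; m+n≤o⇒n≤o; m≤n⇒m≤1+n; ≤-refl)
open import Algebra.Properties.CommutativeSemigroup +-commutativeSemigroup using (xy∙z≈xz∙y)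
open import Data.List using (List; []; _∷_; _++_; length)
open import Data.List.Properties using (length-++; ++-assoc; ++-identityʳ)
open import Data.List.Relation.Unary.All using (All; []; _∷_)
open import Data.Maybe using (Maybe; just; nothing)
open import Data.Product as Product using (_×_; _,_; ∃-syntax; proj₁; proj₂)
open import Data.Unit using (tt)
open import Data.Empty using (⊥-elim)
open import Function using (_∘_; _⇔_; mk⇔; Equivalence)
import Function.Properties.Equivalence as ⇔
open import Relation.Nullary using (¬_)
open import Relation.Binary.PropositionalEquality
  using (_≡_; refl; sym; trans; cong; subst; module ≡-Reasoning)

open Equivalence using (to; from)

IsLukFrom-F : ∀ h {w} → IsLukFrom h (F ∷ w) ⇔ IsLukFrom h w
IsLukFrom-F zero = ⇔.refl
IsLukFrom-F (suc h) = ⇔.refl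

IsLukFrom-Up : ∀ h {k w} → IsLukFrom h (Up k ∷ w) ⇔ IsLukFrom (h + suc k) w
IsLukFrom-Up zero = ⇔.refl
IsLukFrom-Up (suc h) = ⇔.refl

IsLukFrom-Up-F : ∀ h {k w} → IsLukFrom h (Up k ∷ F ∷ w) ⇔ IsLukFrom (h + suc k) w
IsLukFrom-Up-F h {k} = ⇔.trans (IsLukFrom-Up h) (IsLukFrom-F (h + suc k))

IsLukFrom-split : ∀ d {c} w → IsLukFrom (d + suc c) w →
                  ∃[ l ] ∃[ r ] (w ≡ l ++ D ∷ r × IsLukFrom d l × IsLukFrom c r)
IsLukFrom-split zero [] ()
IsLukFrom-split (suc d) [] ()
IsLukFrom-split zero (D ∷ w) lk = [] , w , refl , refl , lk
IsLukFrom-split (suc d) (D ∷ w) lk with IsLukFrom-split d w lk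
... | l , r , refl , lk-l , lk-r = D ∷ l , r , refl , lk-l , lk-r
IsLukFrom-split d {c} (F ∷ w) lk with IsLukFrom-split d w (to (IsLukFrom-F (d + suc c)) lk)
... | l , r , refl , lk-l , lk-r = F ∷ l , r , refl , from (IsLukFrom-F d) lk-l , lk-r
IsLukFrom-split d {c} (Up k ∷ w) lk
  with IsLukFrom-split (d + suc k) w
         (subst (λ h → IsLukFrom h w) (xy∙z≈xz∙y d (suc c) (suc k)) (to (IsLukFrom-Up (d + suc c)) lk))
... | l , r , refl , lk-l , lk-r = Up k ∷ l , r , refl , from (IsLukFrom-Up d) lk-l , lk-r

firstReturn-++ : ∀ {c} l r → IsLukFrom c l → firstReturn c (l ++ D ∷ r) ≡ just (l , r)
firstReturn-++ {zero} [] r refl = refl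
firstReturn-++ {suc c} (D ∷ l) r lk rewrite firstReturn-++ l r lk = refl
firstReturn-++ {zero} (F ∷ l) r lk rewrite firstReturn-++ l r lk = refl
firstReturn-++ {suc c} (F ∷ l) r lk rewrite firstReturn-++ l r lk = refl
firstReturn-++ {zero} (Up k ∷ l) r lk rewrite firstReturn-++ l r lk = refl
firstReturn-++ {suc c} (Up k ∷ l) r lk rewrite firstReturn-++ l r lk = refl

-- The stack entry of an open up step counts its returns still to be written F.
Stack : Set
Stack = List ℕ

ψ-stack : Stack → Path → Path
ψ-stack s [] = []
ψ-stack s (F ∷ w) = F ∷ ψ-stack s w
ψ-stack s (Up k ∷ w) = U ∷ ψ-stack (k ∷ s) w
ψ-stack [] (D ∷ w) = D ∷ ψ-stack [] w
ψ-stack (zero ∷ s) (D ∷ w) = D ∷ ψ-stack s w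
ψ-stack (suc t ∷ s) (D ∷ w) = F ∷ ψ-stack (t ∷ s) w

length-ψ-stack : ∀ s w → length (ψ-stack s w) ≡ length w
length-ψ-stack s [] = refl
length-ψ-stack s (F ∷ w) = cong suc (length-ψ-stack s w)
length-ψ-stack s (Up k ∷ w) = cong suc (length-ψ-stack (k ∷ s) w)
length-ψ-stack [] (D ∷ w) = cong suc (length-ψ-stack [] w)
length-ψ-stack (zero ∷ s) (D ∷ w) = cong suc (length-ψ-stack s w)
length-ψ-stack (suc t ∷ s) (D ∷ w) = cong suc (length-ψ-stack (t ∷ s) w)

length-return≤ : ∀ l r {f} → length (l ++ D ∷ r) ≤ suc f → length l ≤ f × length r ≤ f
length-return≤ l r le with subst (_≤ suc _) (trans (length-++ l) (+-suc (length l) (length r))) le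
... | s≤s le′ = m+n≤o⇒m≤o (length l) le′ , m+n≤o⇒n≤o (length l) le′

-- What `pieces f m` emits from the return D that ends its first piece onwards.
ψ-after-return : ℕ → ℕ → Path → Path
ψ-after-return f zero r = D ∷ ψ-fuel f r
ψ-after-return f (suc m) r = F ∷ pieces f m r

pieces-return : ∀ f m l r → IsLuk l → pieces f m (l ++ D ∷ r) ≡ ψ-fuel f l ++ ψ-after-return f m r
pieces-return f m l r lk rewrite firstReturn-++ l r lk with m
... | zero = refl
... | suc m = refl

mutual
  ψ-fuel-++ : ∀ {f} w → IsLuk w → length w ≤ f → ∀ s rest →
              ψ-stack s (w ++ rest) ≡ ψ-fuel f w ++ ψ-stack s rest
  ψ-fuel-++ {zero} [] _ _ s rest = refl
  ψ-fuel-++ {suc f} [] _ _ s rest = refl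
  ψ-fuel-++ {suc f} (F ∷ w) lk (s≤s le) s rest = cong (F ∷_) (ψ-fuel-++ w lk le s rest)
  ψ-fuel-++ {suc f} (Up k ∷ w) lk (s≤s le) s rest =
    cong (U ∷_) (pieces-++ w lk (m≤n⇒m≤1+n le) s rest)

  pieces-++ : ∀ {f m} w → IsLukFrom (suc m) w → length w ≤ suc f → ∀ s rest →
              ψ-stack (m ∷ s) (w ++ rest) ≡ pieces f m w ++ ψ-stack s rest
  pieces-++ {f} {m} w lk le s rest with IsLukFrom-split 0 w lk
  ... | l , r , refl , lk-l , lk-r = begin
    ψ-stack (m ∷ s) ((l ++ D ∷ r) ++ rest)
      ≡⟨ cong (ψ-stack (m ∷ s)) (++-assoc l (D ∷ r) rest) ⟩
    ψ-stack (m ∷ s) (l ++ D ∷ r ++ rest)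
      ≡⟨ ψ-fuel-++ l lk-l le-l (m ∷ s) (D ∷ r ++ rest) ⟩
    ψ-fuel f l ++ ψ-stack (m ∷ s) (D ∷ r ++ rest)
      ≡⟨ cong (ψ-fuel f l ++_) (ψ-stack-after-return m r lk-r le-r s rest) ⟩
    ψ-fuel f l ++ ψ-after-return f m r ++ ψ-stack s rest
      ≡⟨ ++-assoc (ψ-fuel f l) (ψ-after-return f m r) (ψ-stack s rest) ⟨
    (ψ-fuel f l ++ ψ-after-return f m r) ++ ψ-stack s rest
      ≡⟨ cong (_++ ψ-stack s rest) (pieces-return f m l r lk-l) ⟨
    pieces f m (l ++ D ∷ r) ++ ψ-stack s rest ∎
    where
    open ≡-Reasoning
    le-l : length l ≤ f
    le-l = proj₁ (length-return≤ l r le)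
    le-r : length r ≤ f
    le-r = proj₂ (length-return≤ l r le)

  ψ-stack-after-return : ∀ {f} m r → IsLukFrom m r → length r ≤ f → ∀ s rest →
    ψ-stack (m ∷ s) (D ∷ r ++ rest) ≡ ψ-after-return f m r ++ ψ-stack s rest
  ψ-stack-after-return zero r lk le s rest = cong (D ∷_) (ψ-fuel-++ r lk le s rest)
  ψ-stack-after-return (suc m) r lk le s rest =
    cong (F ∷_) (pieces-++ r lk (m≤n⇒m≤1+n le) s rest)

ψ≡ψ-stack : ∀ {w} → IsLuk w → ψ w ≡ ψ-stack [] w
ψ≡ψ-stack {w} lk = begin
  ψ w                       ≡⟨ ++-identityʳ (ψ w) ⟨
  ψ w ++ ψ-stack [] []      ≡⟨ ψ-fuel-++ w lk ≤-refl [] [] ⟨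
  ψ-stack [] (w ++ [])      ≡⟨ cong (ψ-stack []) (++-identityʳ w) ⟩
  ψ-stack [] w              ∎
  where open ≡-Reasoning

-- In 𝓔 every U_k comes with the F after it, so paths are read in the letters
-- F (at height 0), U_k F, and D; the stack is that of ψ-stack.
data IsEFrom : Stack → Path → Set where
  done        : IsEFrom [] []
  flat        : ∀ {w} → IsEFrom [] w → IsEFrom [] (F ∷ w)
  up-flat     : ∀ {k s w} → IsEFrom (k ∷ s) w → IsEFrom s (Up k ∷ F ∷ w)
  return      : ∀ {t s w} → IsEFrom (t ∷ s) w → IsEFrom (suc t ∷ s) (D ∷ w)
  last-return : ∀ {s w} → IsEFrom s w → IsEFrom (zero ∷ s) (D ∷ w)

height : Stack → ℕ
height [] = 0
height (t ∷ s) = suc (t + height s)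

height-push : ∀ s k → height s + suc k ≡ height (k ∷ s)
height-push s k = trans (+-suc (height s) k) (cong suc (+-comm (height s) k))

NotUp : Maybe Step → Set
NotUp prev = ¬ (∃[ k ] (prev ≡ just (Up k)))

-- As U_k F is read as one letter, the step before a letter is never an up step.
E⇒IsEFrom : ∀ {prev} s w → IsLukFrom (height s) w → UpFollowedByF w →
            FlatPreceded prev (height s) w → NotUp prev → IsEFrom s w
E⇒IsEFrom [] [] lk u fp ¬up = done
E⇒IsEFrom [] (F ∷ w) lk u (_ , fp) ¬up = flat (E⇒IsEFrom [] w lk u fp λ ())
E⇒IsEFrom (t ∷ s) (F ∷ w) lk u (preceded-by-up , _) ¬up = ⊥-elim (¬up (preceded-by-up (s≤s z≤n)))
E⇒IsEFrom (zero ∷ s) (D ∷ w) lk u fp ¬up = last-return (E⇒IsEFrom s w lk u fp λ ())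
E⇒IsEFrom (suc t ∷ s) (D ∷ w) lk u fp ¬up = return (E⇒IsEFrom (t ∷ s) w lk u fp λ ())
E⇒IsEFrom s (Up k ∷ F ∷ w) lk (_ , u) (_ , fp) ¬up =
  up-flat (E⇒IsEFrom (k ∷ s) w
    (subst (λ h → IsLukFrom h w) (height-push s k) (to (IsLukFrom-Up-F (height s)) lk))
    u
    (subst (λ h → FlatPreceded (just F) h w) (height-push s k) fp)
    λ ())

IsEFrom⇒E : ∀ prev {s w} → IsEFrom s w →
            IsLukFrom (height s) w × UpFollowedByF w × FlatPreceded prev (height s) w
IsEFrom⇒E prev done = refl , tt , tt
IsEFrom⇒E prev (flat e) with IsEFrom⇒E (just F) e
... | lk , u , fp = lk , u , (λ ()) , fp
IsEFrom⇒E prev (up-flat {k} {s} {w} e) with IsEFrom⇒E (just F) e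
... | lk , u , fp =
  from (IsLukFrom-Up-F (height s)) (subst (λ h → IsLukFrom h w) (sym (height-push s k)) lk) ,
  (refl , u) ,
  (λ _ → k , refl) , subst (λ h → FlatPreceded (just F) h w) (sym (height-push s k)) fp
IsEFrom⇒E prev (return e) = IsEFrom⇒E (just D) e
IsEFrom⇒E prev (last-return e) = IsEFrom⇒E (just D) e

data IsMFrom : ℕ → Path → Set where
  done    : IsMFrom 0 []
  flat    : ∀ {h m} → IsMFrom h m → IsMFrom h (F ∷ m)
  up-flat : ∀ {h m} → IsMFrom (suc h) m → IsMFrom h (U ∷ F ∷ m)
  down    : ∀ {h m} → IsMFrom h m → IsMFrom (suc h) (D ∷ m)

IsMFrom⇒Motzkin : ∀ {h m} → IsMFrom h m → IsLukFrom h m × All MotzkinStep m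
IsMFrom⇒Motzkin done = refl , []
IsMFrom⇒Motzkin (flat {h} d) = Product.map (from (IsLukFrom-F h)) (tt ∷_) (IsMFrom⇒Motzkin d)
IsMFrom⇒Motzkin (up-flat {h} {m} d) =
  Product.map (from (IsLukFrom-Up-F h) ∘ subst (λ x → IsLukFrom x m) (+-comm 1 h))
              (λ ms → tt ∷ tt ∷ ms)
              (IsMFrom⇒Motzkin d)
IsMFrom⇒Motzkin (down d) = Product.map₂ (tt ∷_) (IsMFrom⇒Motzkin d)

IsMFrom-tail : ∀ {h x m} → IsMFrom h (x ∷ m) → ∃[ h′ ] IsMFrom h′ m
IsMFrom-tail (flat d) = _ , d
IsMFrom-tail (up-flat d) = _ , flat d
IsMFrom-tail (down d) = _ , d

IsMFrom-U-F : ∀ {h t m} → IsMFrom h m → Occurs₂ U t m → t ≡ F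
IsMFrom-U-F d ([] , b , refl) with d
... | up-flat _ = refl
IsMFrom-U-F d (x ∷ a , b , refl) = IsMFrom-U-F (proj₂ (IsMFrom-tail d)) (a , b , refl)

Occurs₂-∷ : ∀ {s t x m} → Occurs₂ s t m → Occurs₂ s t (x ∷ m)
Occurs₂-∷ {x = x} (a , b , refl) = x ∷ a , b , refl

Motzkin⇒IsMFrom : ∀ h m → IsLukFrom h m → All MotzkinStep m →
                  ¬ Occurs₂ U U m → ¬ Occurs₂ U D m → IsMFrom h m
Motzkin⇒IsMFrom zero [] refl ms ¬UU ¬UD = done
Motzkin⇒IsMFrom h (F ∷ m) lk (_ ∷ ms) ¬UU ¬UD =
  flat (Motzkin⇒IsMFrom h m (to (IsLukFrom-F h) lk) ms (¬UU ∘ Occurs₂-∷) (¬UD ∘ Occurs₂-∷))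
Motzkin⇒IsMFrom (suc h) (D ∷ m) lk (_ ∷ ms) ¬UU ¬UD =
  down (Motzkin⇒IsMFrom h m lk ms (¬UU ∘ Occurs₂-∷) (¬UD ∘ Occurs₂-∷))
Motzkin⇒IsMFrom h (Up (suc _) ∷ m) lk (() ∷ ms) ¬UU ¬UD
Motzkin⇒IsMFrom zero (Up zero ∷ []) () ms ¬UU ¬UD
Motzkin⇒IsMFrom (suc h) (Up zero ∷ []) () ms ¬UU ¬UD
Motzkin⇒IsMFrom h (Up zero ∷ F ∷ m) lk (_ ∷ _ ∷ ms) ¬UU ¬UD =
  up-flat (Motzkin⇒IsMFrom (suc h) m
    (subst (λ x → IsLukFrom x m) (+-comm h 1) (to (IsLukFrom-Up-F h) lk)) ms
    (¬UU ∘ Occurs₂-∷ ∘ Occurs₂-∷) (¬UD ∘ Occurs₂-∷ ∘ Occurs₂-∷))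
Motzkin⇒IsMFrom h (Up zero ∷ D ∷ m) lk ms ¬UU ¬UD = ⊥-elim (¬UD ([] , m , refl))
Motzkin⇒IsMFrom h (Up zero ∷ Up zero ∷ m) lk ms ¬UU ¬UD = ⊥-elim (¬UU ([] , m , refl))
Motzkin⇒IsMFrom h (Up zero ∷ Up (suc _) ∷ m) lk (_ ∷ () ∷ ms) ¬UU ¬UD

ψ-stack-IsMFrom : ∀ {s w} → IsEFrom s w → IsMFrom (length s) (ψ-stack s w)
ψ-stack-IsMFrom done = done
ψ-stack-IsMFrom (flat e) = flat (ψ-stack-IsMFrom e)
ψ-stack-IsMFrom (up-flat e) = up-flat (ψ-stack-IsMFrom e)
ψ-stack-IsMFrom (return e) = flat (ψ-stack-IsMFrom e)
ψ-stack-IsMFrom (last-return e) = down (ψ-stack-IsMFrom e)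

decode : Path → Stack × Path
decode [] = [] , []
decode (F ∷ m) with decode m
... | [] , w = [] , F ∷ w
... | t ∷ s , w = suc t ∷ s , D ∷ w
decode (D ∷ m) with decode m
... | s , w = zero ∷ s , D ∷ w
decode (Up _ ∷ F ∷ m) with decode m
... | k ∷ s , w = s , Up k ∷ F ∷ w
... | [] , w = [] , w
decode (Up _ ∷ _) = [] , []

decode-ψ-stack : ∀ {s w} → IsEFrom s w → decode (ψ-stack s w) ≡ (s , w)
decode-ψ-stack done = refl
decode-ψ-stack (flat e) rewrite decode-ψ-stack e = refl
decode-ψ-stack (up-flat e) rewrite decode-ψ-stack e = refl
decode-ψ-stack (return e) rewrite decode-ψ-stack e = refl
decode-ψ-stack (last-return e) rewrite decode-ψ-stack e = refl

ψ-stack-injective : ∀ {s s′ w w′} → IsEFrom s w → IsEFrom s′ w′ →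
                    ψ-stack s w ≡ ψ-stack s′ w′ → w ≡ w′
ψ-stack-injective {s} {s′} {w} {w′} e e′ eq = cong proj₂ (begin
  (s , w)                 ≡⟨ decode-ψ-stack e ⟨
  decode (ψ-stack s w)    ≡⟨ cong decode eq ⟩
  decode (ψ-stack s′ w′)  ≡⟨ decode-ψ-stack e′ ⟩
  (s′ , w′)               ∎)
  where open ≡-Reasoning

ψ-stack-surjective : ∀ {h m} → IsMFrom h m →
                     ∃[ s ] ∃[ w ] (IsEFrom s w × length s ≡ h × ψ-stack s w ≡ m)
ψ-stack-surjective done = [] , [] , done , refl , refl
ψ-stack-surjective (flat d) with ψ-stack-surjective d
... | [] , w , e , refl , refl = [] , F ∷ w , flat e , refl , refl
... | t ∷ s , w , e , refl , refl = suc t ∷ s , D ∷ w , return e , refl , refl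
ψ-stack-surjective (up-flat d) with ψ-stack-surjective d
... | k ∷ s , w , e , refl , refl = s , Up k ∷ F ∷ w , up-flat e , refl , refl
ψ-stack-surjective (down d) with ψ-stack-surjective d
... | s , w , e , refl , refl = zero ∷ s , D ∷ w , last-return e , refl , refl

InE⇔IsEFrom : ∀ {n w} → InE n w ⇔ (length w ≡ n × IsEFrom [] w)
InE⇔IsEFrom {w = w} = mk⇔
  (λ (len , lk , u , fp) → len , E⇒IsEFrom [] w lk u fp λ ())
  (λ (len , e) → len , IsEFrom⇒E nothing e)

InM⇔IsMFrom : ∀ {n m} → InM n m ⇔ (length m ≡ n × IsMFrom 0 m)
InM⇔IsMFrom {m = m} = mk⇔
  (λ (len , (lk , ms) , ¬UU , ¬UD) → len , Motzkin⇒IsMFrom 0 m lk ms ¬UU ¬UD)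
  (λ (len , d) → len , IsMFrom⇒Motzkin d , (λ ()) ∘ IsMFrom-U-F d , (λ ()) ∘ IsMFrom-U-F d)

theorem11 : (n : ℕ) →
    (∀ w → InE n w → InM n (ψ w))
    × (∀ w w′ → InE n w → InE n w′ → ψ w ≡ ψ w′ → w ≡ w′)
    × (∀ m → InM n m → ∃[ w ] (InE n w × ψ w ≡ m))
theorem11 n = maps-into , injective , surjective
  where
  ψ-on-E : ∀ {w} → InE n w → ψ w ≡ ψ-stack [] w
  ψ-on-E (_ , lk , _) = ψ≡ψ-stack lk

  maps-into : ∀ w → InE n w → InM n (ψ w)
  maps-into w inE with to InE⇔IsEFrom inE
  ... | len , e = subst (InM n) (sym (ψ-on-E inE))
                    (from InM⇔IsMFrom (trans (length-ψ-stack [] w) len , ψ-stack-IsMFrom e))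

  injective : ∀ w w′ → InE n w → InE n w′ → ψ w ≡ ψ w′ → w ≡ w′
  injective w w′ inE inE′ eq =
    ψ-stack-injective (proj₂ (to InE⇔IsEFrom inE)) (proj₂ (to InE⇔IsEFrom inE′))
      (trans (sym (ψ-on-E inE)) (trans eq (ψ-on-E inE′)))

  surjective : ∀ m → InM n m → ∃[ w ] (InE n w × ψ w ≡ m)
  surjective m inM with to InM⇔IsMFrom inM
  ... | len , d with ψ-stack-surjective d
  ... | [] , w , e , refl , refl = w , inE , ψ-on-E inE
    where
    inE : InE n w
    inE = from InE⇔IsEFrom (trans (sym (length-ψ-stack [] w)) len , e)
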